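{- Let $M_G$ be a mixed graph whose underlying graph $G$ is simple, finite and connected. Then $M_G$ has property $SP$ if and only if every mixed cycle of $M_G$ belongs to $\Phi_4$.
   Context: A mixed graph $M_G$ is obtained from $G$ by giving directions to some of its edges. $M_G$ has property $SP$ if its vertex set can be partitioned into six (possibly empty) parts $V_1,\dots,V_6$ such that every undirected edge has both endpoints in the same part, and every directed edge goes from a vertex of $V_i$ to a vertex of $V_{i+1}$ for some $i\in\{1,\dots,5\}$, or from a vertex of $V_6$ to a vertex of $V_1$. A mixed cycle of $M_G$ is the mixed subgraph on a cycle of $G$. For a mixed cycle, fix one of its two cyclic traversal directions and let $a$ (resp. $b$) be the number of directed edges oriented along (resp. against) the traversal; the cycle belongs to $\Phi_4$ if $a-b\equiv 0\pmod 6$. -}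

module Defs where

open import Data.Nat using (ℕ; zero; suc; _≤_)
open import Data.Fin using (Fin; zero; suc; inject₁; fromℕ)
open import Data.Integer using (ℤ; +_; -_; _+_)
open import Data.Integer.Divisibility using (_∣_)
open import Data.Product using (Σ; _×_; ∃)
open import Function.Definitions using (Injective)
open import Relation.Binary.PropositionalEquality using (_≡_)
open import Relation.Nullary using (¬_)

-- Status of an ordered pair (u , v) of vertices in a mixed graph:
-- no edge, undirected edge, directed edge u → v (fwd), directed edge v → u (bwd).
data Kind : Set where
  none undir fwd bwd : Kind

flipK : Kind → Kind
flipK none  = none
flipK undir = undir
flipK fwd   = bwd
flipK bwd   = fwd

-- A mixed graph on vertex set Fin n. Its underlying graph G (edges = pairs
-- with kind ≠ none) is simple: loopless, symmetric, at most one edge per pair.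
record MixedGraph (n : ℕ) : Set where
  field
    kind     : Fin n → Fin n → Kind
    kind-sym : ∀ u v → kind v u ≡ flipK (kind u v)
    loopless : ∀ u → kind u u ≡ none

open MixedGraph public

Adj : ∀ {n} → MixedGraph n → Fin n → Fin n → Set
Adj M u v = ¬ (kind M u v ≡ none)

data Walk {n} (M : MixedGraph n) : Fin n → Fin n → Set where
  here : ∀ {u} → Walk M u u
  step : ∀ {u v w} → Adj M u v → Walk M v w → Walk M u w

Connected : ∀ {n} → MixedGraph n → Set
Connected {n} M = ∀ (u v : Fin n) → Walk M u v

suc6 : Fin 6 → Fin 6
suc6 zero = suc zero
suc6 (suc zero) = suc (suc zero)
suc6 (suc (suc zero)) = suc (suc (suc zero))
suc6 (suc (suc (suc zero))) = suc (suc (suc (suc zero)))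
suc6 (suc (suc (suc (suc zero)))) = suc (suc (suc (suc (suc zero))))
suc6 (suc (suc (suc (suc (suc zero))))) = zero

-- Property SP: a partition V₁,…,V₆ (given by a part-assignment p : V → Fin 6)
-- such that undirected edges stay inside a part and every arc goes from
-- V_i to V_{i+1} (indices mod 6, so V₆ → V₁).
HasSP : ∀ {n} → MixedGraph n → Set
HasSP {n} M = Σ (Fin n → Fin 6) λ p →
  (∀ u v → kind M u v ≡ undir → p u ≡ p v) ×
  (∀ u v → kind M u v ≡ fwd → p v ≡ suc6 (p u))

-- A cycle of G of length suc m ≥ 3: distinct vertices c 0, …, c m with
-- c i ~ c (i+1) and c m ~ c 0.
record Cycle {n} (M : MixedGraph n) : Set where
  field
    m      : ℕ
    len≥3  : 2 ≤ m
    vert   : Fin (suc m) → Fin n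
    inj    : Injective _≡_ _≡_ vert
    adj    : ∀ (i : Fin m) → Adj M (vert (inject₁ i)) (vert (suc i))
    adjEnd : Adj M (vert (fromℕ m)) (vert zero)

weight : Kind → ℤ
weight none  = + 0
weight undir = + 0
weight fwd   = + 1
weight bwd   = - (+ 1)

sumFin : ∀ {k} → (Fin k → ℤ) → ℤ
sumFin {zero}  f = + 0
sumFin {suc k} f = f zero + sumFin (λ i → f (suc i))

-- a - b for the traversal c 0 → c 1 → … → c m → c 0
cycleValue : ∀ {n} {M : MixedGraph n} → Cycle M → ℤ
cycleValue {M = M} C =
  sumFin (λ i → weight (kind M (vert (inject₁ i)) (vert (suc i))))
  + weight (kind M (vert (fromℕ m)) (vert zero))
  where open Cycle C

InΦ₄ : ∀ {n} {M : MixedGraph n} → Cycle M → Set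
InΦ₄ C = + 6 ∣ cycleValue C

-- Both conditions are equivalent to the existence of an integer potential h with
-- h v ≡ h u + (weight of the edge u v) (mod 6) across every edge.  The part indices of an
-- SP partition form such a potential, and along a cycle the potential differences
-- telescope, so every cycle weight is ≡ 0.  Conversely, if all cycles have weight ≡ 0 then
-- so do all closed walks: cutting a closed walk at a repeated vertex yields two shorter
-- closed walks, and a closed walk without repetition is a cycle or runs back and forth
-- along a single edge.  In a connected graph the weight of a walk from a fixed root to v
-- is then a potential, and its residues mod 6 give the partition.

module Submission where

open import Defs
open import Data.Nat using (ℕ)
open import Function.Bundles using (_⇔_)

open import Data.Nat using (zero; suc; _<_; z≤n; s≤s)
import Data.Nat as ℕ
import Data.Nat.Properties as ℕ
open import Data.Nat.GeneralisedArithmetic using (fold)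
open import Data.Nat.Induction using (<-wellFounded)
open import Induction.WellFounded using (Acc; acc)
open import Data.Fin using (Fin; zero; suc; inject₁; fromℕ; toℕ)
open import Data.Fin.Properties using (_≟_; all?)
open import Data.Integer using (ℤ; +_; -[1+_]; _+_; _-_; -_; _*_; 0ℤ; 1ℤ)
open import Data.Integer.Properties using (+-identityˡ; +-identityʳ; +-assoc; +-comm; pos-*)
open import Data.Integer.Tactic.RingSolver using (solve-∀)
open import Data.Integer.Divisibility.Signed
  using (_∣_; divides; _∣?_; ∣m∣n⇒∣m+n; ∣m∣n⇒∣m-n; ∣m⇒∣-m; ∣⇒∣ᵤ; ∣ᵤ⇒∣)
open import Data.Product using (Σ; _×_; _,_)
open import Data.Empty using (⊥-elim)
open import Data.List using (List; []; _∷_; _++_; [_]; length; lookup)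
open import Data.List.Properties using (length-++-≤ˡ; length-++-≤ʳ; ++-assoc)
open import Data.List.Relation.Unary.Any using (any?)
import Data.List.Relation.Unary.All as All
open import Data.List.Relation.Unary.All.Properties using (¬Any⇒All¬)
open import Data.List.Relation.Unary.AllPairs using ([]; _∷_)
open import Data.List.Relation.Unary.Linked using (Linked; [-]; _∷_)
open import Data.List.Relation.Unary.Unique.Propositional using (Unique)
open import Data.List.Membership.Propositional.Properties using (∈-lookup; ∈-∃++)
open import Function.Base using (_∘_)
open import Function.Bundles using (mk⇔)
open import Relation.Binary.Definitions using (DecidableEquality)
open import Relation.Nullary.Decidable using (yes; no; toWitness)
open import Relation.Binary.PropositionalEquality
  using (_≡_; _≢_; refl; sym; trans; cong; cong₂; subst; module ≡-Reasoning)

suc6⁶ : ∀ x → fold x suc6 6 ≡ x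
suc6⁶ = toWitness {a? = all? λ x → fold x suc6 6 ≟ x} _

fold-suc6-*6 : ∀ x k → fold x suc6 (k ℕ.* 6) ≡ x
fold-suc6-*6 x zero    = refl
fold-suc6-*6 x (suc k) = trans (suc6⁶ (fold x suc6 (k ℕ.* 6))) (fold-suc6-*6 x k)

-- The negative clause uses −1 ≡ 5 (mod 6).
mod6 : ℤ → Fin 6
mod6 (+ n)    = fold zero suc6 n
mod6 -[1+ n ] = fold zero suc6 (suc n ℕ.* 5)

mod6-suc : ∀ z → mod6 (z + 1ℤ) ≡ suc6 (mod6 z)
mod6-suc (+ n)        = cong (fold zero suc6) (ℕ.+-comm n 1)
mod6-suc -[1+ zero ]  = refl
mod6-suc -[1+ suc n ] = sym (suc6⁶ (mod6 -[1+ n ]))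

mod6-+ : ∀ z n → mod6 (z + + n) ≡ fold (mod6 z) suc6 n
mod6-+ z zero    = cong mod6 (+-identityʳ z)
mod6-+ z (suc n) = begin
  mod6 (z + + suc n)      ≡⟨ cong mod6 (shift z (+ n)) ⟩
  mod6 ((z + + n) + 1ℤ)   ≡⟨ mod6-suc (z + + n) ⟩
  suc6 (mod6 (z + + n))   ≡⟨ cong suc6 (mod6-+ z n) ⟩
  fold (mod6 z) suc6 (suc n) ∎
  where
  open ≡-Reasoning
  shift : ∀ z k → z + (1ℤ + k) ≡ (z + k) + 1ℤ
  shift = solve-∀

mod6-+*6 : ∀ z q → mod6 (z + q * + 6) ≡ mod6 z
mod6-+*6 z (+ k) = begin
  mod6 (z + + k * + 6)     ≡⟨ cong (λ t → mod6 (z + t)) (sym (pos-* k 6)) ⟩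
  mod6 (z + + (k ℕ.* 6))   ≡⟨ mod6-+ z (k ℕ.* 6) ⟩
  fold (mod6 z) suc6 (k ℕ.* 6) ≡⟨ fold-suc6-*6 (mod6 z) k ⟩
  mod6 z                   ∎
  where open ≡-Reasoning
mod6-+*6 z -[1+ k ] = sym (begin
  mod6 z                        ≡⟨ cong mod6 (cancel z (+ suc k)) ⟩
  mod6 (z' + + suc k * + 6)     ≡⟨ mod6-+*6 z' (+ suc k) ⟩
  mod6 z'                       ∎)
  where
  open ≡-Reasoning
  z' = z + -[1+ k ] * + 6
  cancel : ∀ z x → z ≡ (z + (- x) * + 6) + x * + 6
  cancel = solve-∀

mod6-cong : ∀ a b → + 6 ∣ a - b → mod6 a ≡ mod6 b
mod6-cong a b (divides q a-b≡q*6) = begin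
  mod6 a              ≡⟨ cong mod6 (trans (split a b) (cong (λ t → b + t) a-b≡q*6)) ⟩
  mod6 (b + q * + 6)  ≡⟨ mod6-+*6 b q ⟩
  mod6 b              ∎
  where
  open ≡-Reasoning
  split : ∀ a b → a ≡ b + (a - b)
  split = solve-∀

sumFin-∣ : ∀ {k d} {f : Fin k → ℤ} → (∀ i → d ∣ f i) → d ∣ sumFin f
sumFin-∣ {zero}  _   = divides 0ℤ refl
sumFin-∣ {suc k} d∣f = ∣m∣n⇒∣m+n (d∣f zero) (sumFin-∣ (d∣f ∘ suc))

sumFin-telescope : ∀ m (g : Fin (suc m) → ℤ) (f : Fin m → ℤ) e →
  sumFin (λ i → g (inject₁ i) + f i - g (suc i)) + (g (fromℕ m) + e - g zero)
    ≡ sumFin f + e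
sumFin-telescope zero    g f e = cancel (g zero) e
  where
  cancel : ∀ x e → 0ℤ + (x + e - x) ≡ 0ℤ + e
  cancel = solve-∀
sumFin-telescope (suc m) g f e = begin
  (g zero + f zero - g (suc zero) + S) + (g (fromℕ (suc m)) + e - g zero)
    ≡⟨ regroup (g zero) (f zero) (g (suc zero)) S (g (fromℕ (suc m))) e ⟩
  f zero + (S + (g (fromℕ (suc m)) + e - g (suc zero)))
    ≡⟨ cong (λ t → f zero + t) (sumFin-telescope m (g ∘ suc) (f ∘ suc) e) ⟩
  f zero + (sumFin (f ∘ suc) + e)
    ≡⟨ sym (+-assoc (f zero) _ e) ⟩
  sumFin f + e ∎
  where
  open ≡-Reasoning
  S = sumFin (λ i → g (suc (inject₁ i)) + f (suc i) - g (suc (suc i)))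
  regroup : ∀ g₀ f₀ g₁ s gₘ e → (g₀ + f₀ - g₁ + s) + (gₘ + e - g₀) ≡ f₀ + (s + (gₘ + e - g₁))
  regroup = solve-∀

edgeWeight : ∀ {n} → MixedGraph n → Fin n → Fin n → ℤ
edgeWeight M u v = weight (kind M u v)

edgeWeight-flip : ∀ {n} (M : MixedGraph n) u v → edgeWeight M v u ≡ - edgeWeight M u v
edgeWeight-flip M u v with kind M u v | kind-sym M u v
... | none  | eq = cong weight eq
... | undir | eq = cong weight eq
... | fwd   | eq = cong weight eq
... | bwd   | eq = cong weight eq

IsPotential : ∀ {n} → ℕ → MixedGraph n → (Fin n → ℤ) → Set
IsPotential d M h = ∀ u v → Adj M u v → + d ∣ h u + edgeWeight M u v - h v

HasPotential : ∀ {n} → ℕ → MixedGraph n → Set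
HasPotential {n} d M = Σ (Fin n → ℤ) (IsPotential d M)

potential⇒cycle-∣ : ∀ {n d} {M : MixedGraph n} → HasPotential d M → (C : Cycle M) → + d ∣ cycleValue C
potential⇒cycle-∣ {M = M} (h , pot) C =
  subst (_ ∣_) (sumFin-telescope m (h ∘ vert) (λ i → edgeWeight M (vert (inject₁ i)) (vert (suc i))) _)
    (∣m∣n⇒∣m+n (sumFin-∣ (λ i → pot _ _ (adj i))) (pot _ _ adjEnd))
  where open Cycle C

suc6-toℕ : ∀ x → + 6 ∣ + toℕ x + 1ℤ - + toℕ (suc6 x)
suc6-toℕ = toWitness {a? = all? λ x → + 6 ∣? + toℕ x + 1ℤ - + toℕ (suc6 x)} _

sp⇒potential : ∀ {n} {M : MixedGraph n} → HasSP M → HasPotential 6 M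
sp⇒potential {M = M} (p , undir⇒≡ , fwd⇒suc6) = h , edge
  where
  h : _ → ℤ
  h v = + toℕ (p v)
  edge : ∀ u v → Adj M u v → + 6 ∣ h u + edgeWeight M u v - h v
  edge u v adj with kind M u v in eq
  ... | none  = ⊥-elim (adj refl)
  ... | undir rewrite undir⇒≡ u v eq = divides 0ℤ (cancel (h v))
    where
    cancel : ∀ x → x + 0ℤ - x ≡ 0ℤ * + 6
    cancel = solve-∀
  ... | fwd rewrite fwd⇒suc6 u v eq = suc6-toℕ (p u)
  ... | bwd rewrite fwd⇒suc6 v u (trans (kind-sym M u v) (cong flipK eq)) =
    subst (_ ∣_) (negate (+ toℕ (p v)) (+ toℕ (suc6 (p v)))) (∣m⇒∣-m (suc6-toℕ (p v)))
    where
    negate : ∀ x y → - (x + 1ℤ - y) ≡ y + - 1ℤ - x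
    negate = solve-∀

potential⇒sp : ∀ {n} {M : MixedGraph n} → HasPotential 6 M → HasSP M
potential⇒sp {M = M} (h , pot) = mod6 ∘ h , undir⇒≡ , fwd⇒suc6
  where
  crossing : ∀ u v {k} → kind M u v ≡ k → k ≢ none → mod6 (h u + weight k) ≡ mod6 (h v)
  crossing u v refl adj = mod6-cong (h u + edgeWeight M u v) (h v) (pot u v adj)
  undir⇒≡ : ∀ u v → kind M u v ≡ undir → mod6 (h u) ≡ mod6 (h v)
  undir⇒≡ u v eq = trans (cong mod6 (sym (+-identityʳ (h u)))) (crossing u v eq λ ())
  fwd⇒suc6 : ∀ u v → kind M u v ≡ fwd → mod6 (h v) ≡ suc6 (mod6 (h u))
  fwd⇒suc6 u v eq = trans (sym (crossing u v eq λ ())) (mod6-suc (h u))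

module _ {A : Set} where

  endpoint : A → List A → A
  endpoint x []       = x
  endpoint _ (y ∷ ys) = endpoint y ys

  endpoint-++-∷ : ∀ x xs y ys → endpoint x (xs ++ y ∷ ys) ≡ endpoint y ys
  endpoint-++-∷ x []        y ys = refl
  endpoint-++-∷ x (x′ ∷ xs) y ys = endpoint-++-∷ x′ xs y ys

  endpoint-excise : ∀ x xs y ys zs → endpoint x (xs ++ y ∷ ys ++ y ∷ zs) ≡ endpoint x (xs ++ y ∷ zs)
  endpoint-excise x xs y ys zs = begin
    endpoint x (xs ++ y ∷ ys ++ y ∷ zs) ≡⟨ endpoint-++-∷ x xs y (ys ++ y ∷ zs) ⟩
    endpoint y (ys ++ y ∷ zs)           ≡⟨ endpoint-++-∷ y ys y zs ⟩
    endpoint y zs                       ≡⟨ endpoint-++-∷ x xs y zs ⟨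
    endpoint x (xs ++ y ∷ zs)           ∎
    where open ≡-Reasoning

  lookup-last : ∀ x xs → lookup (x ∷ xs) (fromℕ (length xs)) ≡ endpoint x xs
  lookup-last x []        = refl
  lookup-last x (x′ ∷ xs) = lookup-last x′ xs

  length-loop< : ∀ (xs : List A) x ys zs → length (ys ++ [ x ]) < length (xs ++ x ∷ ys ++ x ∷ zs)
  length-loop< xs x ys zs = begin-strict
    length (ys ++ [ x ])            ≤⟨ length-++-≤ˡ (ys ++ [ x ]) ⟩
    length ((ys ++ [ x ]) ++ zs)    ≡⟨ cong length (++-assoc ys [ x ] zs) ⟩
    length (ys ++ x ∷ zs)           <⟨ ℕ.n<1+n _ ⟩
    length (x ∷ ys ++ x ∷ zs)       ≤⟨ length-++-≤ʳ (x ∷ ys ++ x ∷ zs) {xs} ⟩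
    length (xs ++ x ∷ ys ++ x ∷ zs) ∎
    where open ℕ.≤-Reasoning

  length-excised< : ∀ (xs : List A) x ys zs → length (xs ++ x ∷ zs) < length (xs ++ x ∷ ys ++ x ∷ zs)
  length-excised< []        x ys zs = s≤s (length-++-≤ʳ (x ∷ zs) {ys})
  length-excised< (_ ∷ xs′) x ys zs = s≤s (length-excised< xs′ x ys zs)

module _ {A : Set} {R : A → A → Set} where

  Linked-split : ∀ xs {y ys} → Linked R (xs ++ y ∷ ys) → Linked R (xs ++ [ y ]) × Linked R (y ∷ ys)
  Linked-split []           l       = [-] , l
  Linked-split (_ ∷ [])     (r ∷ l) = r ∷ [-] , l
  Linked-split (_ ∷ x ∷ xs) (r ∷ l) = let l₁ , l₂ = Linked-split (x ∷ xs) l in r ∷ l₁ , l₂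

  Linked-join : ∀ xs {y ys} → Linked R (xs ++ [ y ]) → Linked R (y ∷ ys) → Linked R (xs ++ y ∷ ys)
  Linked-join []           _        l₂ = l₂
  Linked-join (_ ∷ [])     (r ∷ _)  l₂ = r ∷ l₂
  Linked-join (_ ∷ x ∷ xs) (r ∷ l₁) l₂ = r ∷ Linked-join (x ∷ xs) l₁ l₂

  Linked-excise : ∀ xs {x ys zs} → Linked R (xs ++ x ∷ ys ++ x ∷ zs) →
    Linked R (x ∷ ys ++ [ x ]) × Linked R (xs ++ x ∷ zs)
  Linked-excise xs {x} {ys} l =
    let l₁ , l₂ = Linked-split xs l
        l₃ , l₄ = Linked-split (x ∷ ys) l₂
    in  l₃ , Linked-join xs l₁ l₄

  Linked-lookup : ∀ {x xs} → Linked R (x ∷ xs) →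
    ∀ (i : Fin (length xs)) → R (lookup (x ∷ xs) (inject₁ i)) (lookup (x ∷ xs) (suc i))
  Linked-lookup (r ∷ _) zero    = r
  Linked-lookup (_ ∷ l) (suc i) = Linked-lookup l i

module _ {A : Set} (w : A → A → ℤ) where

  pathWeight : List A → ℤ
  pathWeight []           = 0ℤ
  pathWeight (_ ∷ [])     = 0ℤ
  pathWeight (x ∷ y ∷ xs) = w x y + pathWeight (y ∷ xs)

  pathWeight-++-∷ : ∀ xs y ys →
    pathWeight (xs ++ y ∷ ys) ≡ pathWeight (xs ++ [ y ]) + pathWeight (y ∷ ys)
  pathWeight-++-∷ []           y ys = sym (+-identityˡ _)
  pathWeight-++-∷ (x ∷ [])     y ys = cong (_+ pathWeight (y ∷ ys)) (sym (+-identityʳ (w x y)))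
  pathWeight-++-∷ (x ∷ x′ ∷ xs) y ys =
    trans (cong (λ t → w x x′ + t) (pathWeight-++-∷ (x′ ∷ xs) y ys)) (sym (+-assoc (w x x′) _ _))

  pathWeight-excise : ∀ xs x ys zs → pathWeight (xs ++ x ∷ ys ++ x ∷ zs)
    ≡ pathWeight (x ∷ ys ++ [ x ]) + pathWeight (xs ++ x ∷ zs)
  pathWeight-excise xs x ys zs = begin
    pathWeight (xs ++ x ∷ ys ++ x ∷ zs)
      ≡⟨ pathWeight-++-∷ xs x (ys ++ x ∷ zs) ⟩
    pathWeight (xs ++ [ x ]) + pathWeight (x ∷ ys ++ x ∷ zs)
      ≡⟨ cong (λ t → pathWeight (xs ++ [ x ]) + t) (pathWeight-++-∷ (x ∷ ys) x zs) ⟩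
    pathWeight (xs ++ [ x ]) + (pathWeight (x ∷ ys ++ [ x ]) + pathWeight (x ∷ zs))
      ≡⟨ x+[y+z]≡y+[x+z] (pathWeight (xs ++ [ x ])) (pathWeight (x ∷ ys ++ [ x ])) _ ⟩
    pathWeight (x ∷ ys ++ [ x ]) + (pathWeight (xs ++ [ x ]) + pathWeight (x ∷ zs))
      ≡⟨ cong (λ t → pathWeight (x ∷ ys ++ [ x ]) + t) (pathWeight-++-∷ xs x zs) ⟨
    pathWeight (x ∷ ys ++ [ x ]) + pathWeight (xs ++ x ∷ zs) ∎
    where
    open ≡-Reasoning
    x+[y+z]≡y+[x+z] : ∀ a b c → a + (b + c) ≡ b + (a + c)
    x+[y+z]≡y+[x+z] = solve-∀

  pathWeight-lookup : ∀ x xs →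
    sumFin (λ i → w (lookup (x ∷ xs) (inject₁ i)) (lookup (x ∷ xs) (suc i))) ≡ pathWeight (x ∷ xs)
  pathWeight-lookup x []        = refl
  pathWeight-lookup x (x′ ∷ xs) = cong (λ t → w x x′ + t) (pathWeight-lookup x′ xs)

data Repetition {A : Set} (xs : List A) : Set where
  distinct : Unique xs → Repetition xs
  repeats  : ∀ ys x zs ws → xs ≡ ys ++ x ∷ zs ++ x ∷ ws → Repetition xs

repetition : ∀ {A : Set} → DecidableEquality A → (xs : List A) → Repetition xs
repetition _≟_ []       = distinct []
repetition _≟_ (x ∷ xs) with any? (x ≟_) xs | repetition _≟_ xs
... | yes x∈xs | _ with ys , zs , refl ← ∈-∃++ x∈xs = repeats [] x ys zs refl
... | no x∉xs  | distinct xs! = distinct (¬Any⇒All¬ xs x∉xs ∷ xs!)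
... | no _     | repeats ys y zs ws refl = repeats (x ∷ ys) y zs ws refl

lookup-injective : ∀ {A : Set} {xs : List A} → Unique xs → ∀ {i j} → lookup xs i ≡ lookup xs j → i ≡ j
lookup-injective (_  ∷ _)   {zero}  {zero}  _  = refl
lookup-injective (x∉ ∷ _)   {zero}  {suc j} eq = ⊥-elim (All.lookup x∉ (∈-lookup j) eq)
lookup-injective (x∉ ∷ _)   {suc i} {zero}  eq = ⊥-elim (All.lookup x∉ (∈-lookup i) (sym eq))
lookup-injective (_  ∷ xs!) {suc i} {suc j} eq = cong suc (lookup-injective xs! eq)

module _ {n} {M : MixedGraph n} where

  walkWeight : ∀ {u v} → Walk M u v → ℤ
  walkWeight here               = 0ℤ
  walkWeight (step {u} {v} _ W) = edgeWeight M u v + walkWeight W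

  infixr 5 _◅◅_
  _◅◅_ : ∀ {u v w} → Walk M u v → Walk M v w → Walk M u w
  here       ◅◅ W′ = W′
  step adj W ◅◅ W′ = step adj (W ◅◅ W′)

  walkWeight-◅◅ : ∀ {u v w} (W : Walk M u v) (W′ : Walk M v w) →
    walkWeight (W ◅◅ W′) ≡ walkWeight W + walkWeight W′
  walkWeight-◅◅ here                 W′ = sym (+-identityˡ _)
  walkWeight-◅◅ (step {u} {v} _ W) W′ =
    trans (cong (λ t → edgeWeight M u v + t) (walkWeight-◅◅ W W′)) (sym (+-assoc (edgeWeight M u v) _ _))

  -- The vertices of W after its start u, so that the whole walk is u ∷ vertices W.
  vertices : ∀ {u v} → Walk M u v → List (Fin n)
  vertices here               = []
  vertices (step {v = v} _ W) = v ∷ vertices W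

  vertices-linked : ∀ {u v} (W : Walk M u v) → Linked (Adj M) (u ∷ vertices W)
  vertices-linked here         = [-]
  vertices-linked (step adj W) = adj ∷ vertices-linked W

  vertices-endpoint : ∀ {u v} (W : Walk M u v) → endpoint u (vertices W) ≡ v
  vertices-endpoint here       = refl
  vertices-endpoint (step _ W) = vertices-endpoint W

  pathWeight-vertices : ∀ {u v} (W : Walk M u v) → pathWeight (edgeWeight M) (u ∷ vertices W) ≡ walkWeight W
  pathWeight-vertices here               = refl
  pathWeight-vertices (step {u} {v} _ W) = cong (λ t → edgeWeight M u v + t) (pathWeight-vertices W)

module _ {n d} {M : MixedGraph n} (cycle-∣ : ∀ (C : Cycle M) → + d ∣ cycleValue C) where

  simpleClosedWalk-∣ : ∀ u xs → Unique xs → Linked (Adj M) (u ∷ xs) → endpoint u xs ≡ u →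
    + d ∣ pathWeight (edgeWeight M) (u ∷ xs)
  simpleClosedWalk-∣ u []           _    _            _    = divides 0ℤ refl
  simpleClosedWalk-∣ u (_ ∷ [])     _    (adj ∷ [-]) refl = ⊥-elim (adj (loopless M u))
  simpleClosedWalk-∣ u (v ∷ _ ∷ []) _    _            refl = divides 0ℤ (begin
    edgeWeight M u v + (edgeWeight M v u + 0ℤ)   ≡⟨ cong (λ t → edgeWeight M u v + (t + 0ℤ)) (edgeWeight-flip M u v) ⟩
    edgeWeight M u v + (- edgeWeight M u v + 0ℤ) ≡⟨ cancel (edgeWeight M u v) ⟩
    0ℤ * + d                                     ∎)
    where
    open ≡-Reasoning
    cancel : ∀ x → x + (- x + 0ℤ) ≡ 0ℤ * + d
    cancel = solve-∀
  simpleClosedWalk-∣ u (v ∷ xs@(_ ∷ _ ∷ _)) xs! (adj ∷ linked) closed =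
    subst (_ ∣_) value (cycle-∣ C)
    where
    -- The cycle starts at v, so the first edge u v of the walk becomes its closing edge.
    last≡u : lookup (v ∷ xs) (fromℕ (length xs)) ≡ u
    last≡u = trans (lookup-last v xs) closed
    C : Cycle M
    C = record
      { m      = length xs
      ; len≥3  = s≤s (s≤s z≤n)
      ; vert   = lookup (v ∷ xs)
      ; inj    = lookup-injective xs!
      ; adj    = Linked-lookup linked
      ; adjEnd = subst (λ x → Adj M x v) (sym last≡u) adj
      }
    value : cycleValue C ≡ pathWeight (edgeWeight M) (u ∷ v ∷ xs)
    value = trans (cong₂ _+_ (pathWeight-lookup (edgeWeight M) v xs) (cong (λ x → edgeWeight M x v) last≡u))
                  (+-comm (pathWeight (edgeWeight M) (v ∷ xs)) (edgeWeight M u v))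

  closedWalk-∣ : ∀ u xs → Linked (Adj M) (u ∷ xs) → endpoint u xs ≡ u →
    + d ∣ pathWeight (edgeWeight M) (u ∷ xs)
  closedWalk-∣ u xs = go u xs (<-wellFounded (length xs))
    where
    go : ∀ u xs → Acc _<_ (length xs) → Linked (Adj M) (u ∷ xs) → endpoint u xs ≡ u →
      + d ∣ pathWeight (edgeWeight M) (u ∷ xs)
    go u xs (acc shorter) linked closed with repetition _≟_ xs
    ... | distinct xs! = simpleClosedWalk-∣ u xs xs! linked closed
    ... | repeats ys x zs ws refl =
      let loop , rest = Linked-excise (u ∷ ys) linked in
      subst (_ ∣_) (sym (pathWeight-excise (edgeWeight M) (u ∷ ys) x zs ws))
        (∣m∣n⇒∣m+n
          (go x (zs ++ [ x ]) (shorter (length-loop< ys x zs ws)) loop (endpoint-++-∷ x zs x []))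
          (go u (ys ++ x ∷ ws) (shorter (length-excised< ys x zs ws)) rest
            (trans (sym (endpoint-excise u ys x zs ws)) closed)))

  closedWalkWeight-∣ : ∀ {u} (W : Walk M u u) → + d ∣ walkWeight W
  closedWalkWeight-∣ {u} W = subst (_ ∣_) (pathWeight-vertices W)
    (closedWalk-∣ u (vertices W) (vertices-linked W) (vertices-endpoint W))

connected⇒potential : ∀ {n d} {M : MixedGraph n} → Connected M →
  (∀ (C : Cycle M) → + d ∣ cycleValue C) → HasPotential d M
connected⇒potential {zero}          _    _       = (λ ()) , λ ()
connected⇒potential {suc n} {d} {M} walk cycle-∣ = φ , crossing
  where
  φ : Fin (suc n) → ℤ
  φ v = walkWeight (walk zero v)
  crossing : ∀ u v → Adj M u v → + d ∣ φ u + edgeWeight M u v - φ v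
  crossing u v adj = subst (_ ∣_) difference
    (∣m∣n⇒∣m-n (closedWalkWeight-∣ cycle-∣ (walk zero u ◅◅ step adj (walk v zero)))
               (closedWalkWeight-∣ cycle-∣ (walk zero v ◅◅ walk v zero)))
    where
    back = walkWeight (walk v zero)
    cancel : ∀ a w b x → (a + (w + x)) - (b + x) ≡ a + w - b
    cancel = solve-∀
    difference : walkWeight (walk zero u ◅◅ step adj (walk v zero)) - walkWeight (walk zero v ◅◅ walk v zero)
      ≡ φ u + edgeWeight M u v - φ v
    difference = trans (cong₂ _-_ (walkWeight-◅◅ (walk zero u) _) (walkWeight-◅◅ (walk zero v) _))
                       (cancel (φ u) (edgeWeight M u v) (φ v) back)

theorem2p10 : ∀ (n : ℕ) (M : MixedGraph n) → Connected M →
    HasSP M ⇔ (∀ (C : Cycle M) → InΦ₄ C)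
theorem2p10 n M connected = mk⇔
  (λ sp C → ∣⇒∣ᵤ (potential⇒cycle-∣ (sp⇒potential {M = M} sp) C))
  (λ Φ₄ → potential⇒sp {M = M} (connected⇒potential {M = M} connected (∣ᵤ⇒∣ ∘ Φ₄)))
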